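{- Let $p$ and $q$ be distinct odd primes. The number $N_{p,q}$ of solutions $(x,y,z)$ in non-negative integers of $px+qy+z=\frac{q(p-1)}{2}$ is $$N_{p,q}=\frac{p+1}{2}+\sum_{i=1}^{\frac{p-1}{2}}\Big\lfloor\frac{iq}{p}\Big\rfloor.$$ Consequently the Legendre symbol satisfies $\left(\frac{q}{p}\right)=(-1)^{N_{p,q}-\frac{p+1}{2}}$.
   Context: $\left(\frac{q}{p}\right)$ is the Legendre symbol. $\lfloor t\rfloor$ is the greatest integer $\le t$. -}

module Defs where

open import Data.Nat using (ℕ; zero; suc; _+_; _*_; _≡ᵇ_)
open import Data.Nat.DivMod using (_/_; _%_)
open import Data.Bool using (Bool; true; false; if_then_else_)
open import Data.List using (List; length; filterᵇ; upTo; map; cartesianProduct)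
open import Data.Bool.ListAction using (any)
open import Data.Nat.ListAction using (sum)
open import Data.Product using (_×_; _,_)
open import Data.Integer using (ℤ; +_; -_)

-- ⌊ a / b ⌋ for b ≥ 1 (value for b = 0 is irrelevant junk, set to 0)
floorDiv : ℕ → ℕ → ℕ
floorDiv a zero    = 0
floorDiv a (suc k) = a / suc k

-- N_{p,q}: the number of triples (x,y,z) of non-negative integers with
-- p*x + q*y + z = M, where M = q(p-1)/2.  Every solution has x,y,z ≤ M
-- (p,q ≥ 1), so we enumerate all triples in [0,M]^3 and count.
numSolutions : ℕ → ℕ → ℕ → ℕ
numSolutions p q M =
  length (filterᵇ (λ { (x , (y , z)) → (p * x + q * y + z) ≡ᵇ M })
                  (cartesianProduct (upTo (suc M))
                    (cartesianProduct (upTo (suc M)) (upTo (suc M)))))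

Npq : ℕ → ℕ → ℕ
Npq p q = numSolutions p q ((q * (p Data.Nat.∸ 1)) / 2)

legendre : ℕ → ℕ → ℤ
legendre a zero = + 0
legendre a (suc k) =
  if (a % suc k) ≡ᵇ 0 then + 0
  else (if any (λ x → ((x * x) % suc k) ≡ᵇ (a % suc k)) (upTo (suc k))
        then + 1 else - (+ 1))

floorSum : ℕ → ℕ → ℕ → ℕ
floorSum p q n = sum (map (λ j → floorDiv (suc j * q) p) (upTo n))

-- Counting: z is determined by x and y, and with M = q h, h = (p - 1) / 2, a
-- value y contributes ⌊q (h - y) / p⌋ + 1 choices of x when y ≤ h and none
-- otherwise. Reversing y ↦ h - y gives N = h + 1 + Σ_{j=1}^{h} ⌊j q / p⌋.
--
-- The Legendre symbol: this is Eisenstein's lemma. Gauss's lemma gives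
-- q^h ≡ (-1)^μ (mod p), where μ counts the i ≤ h whose residue i q mod p exceeds
-- h; summing i q = p ⌊i q / p⌋ + (i q mod p) over i ≤ h and reducing mod 2 (p
-- and q are odd) shows μ ≡ Σ ⌊i q / p⌋. Euler's criterion, q^h ≡ 1 or -1
-- according as q is a square mod p or not, follows for squares from Gauss's
-- lemma applied to a square root of q, and for non-squares by pairing each unit
-- x with the unit y such that x y ≡ q, which gives (p - 1)! ≡ q^h; Wilson's
-- theorem (p - 1)! ≡ -1 comes from the same pairing with 1 in place of q.

module Submission where

-- A module of its own, so that _^_ in the statement below can be the power on ℤ
-- while the lemmas use the power on ℕ.
module Lemmas where

  open import Defs
  open import Level using (0ℓ)
  open import Function using (_∘_)
  open import Data.Empty using (⊥-elim)
  open import Data.Bool using (Bool; true; false; T; if_then_else_)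
  open import Data.Bool.ListAction using (any)
  open import Data.Sum using (_⊎_; inj₁; inj₂)
  open import Data.Product using (∃-syntax; _×_; _,_; proj₁; proj₂)
  open import Data.Nat using (ℕ; zero; suc; _+_; _*_; _∸_; _/_; _%_; _^_; _!; ⌊_/2⌋; _≤_; _<_; _≤ᵇ_; _≡ᵇ_; _≟_; _≤?_; _<?_; z≤n; s≤s; z<s; s<s; NonZero; >-nonZero⁻¹)
  open import Data.Nat.Properties
  open import Data.Nat.DivMod hiding (_mod_)
  open import Data.Nat.Divisibility using (_∣_; _∤_; divides; ∣⇒≤; ∣1⇒≡1; m%n≡0⇒n∣m; n∣m⇒m%n≡0; ∣m⇒∣m*n)
  open import Data.Nat.Primality using (Prime; euclidsLemma; ¬prime[1]; prime⇒irreducible)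
  open import Data.Nat.ListAction using (sum; product)
  open import Data.Nat.ListAction.Properties using (sum-++; sum-↭; product-++; product-↭)
  open import Data.Nat.Tactic.RingSolver using (solve-∀)
  open import Data.Integer using (1ℤ; -1ℤ) renaming (_^_ to _^ℤ_)
  import Data.Integer.Properties as ℤ
  open import Data.List using (List; []; _∷_; _++_; map; length; upTo; filterᵇ; cartesianProduct)
  open import Data.List.Properties using (map-id; map-cong; map-∘; map-++; map-upTo; upTo-∷ʳ; length-upTo; length-map)
  open import Data.List.Membership.Propositional using (_∈_; lose)
  open import Data.List.Membership.Propositional.Properties using (∈-map⁺; ∈-map⁻; ∈-upTo⁺; ∈-upTo⁻)
  open import Data.List.Relation.Unary.Any using (here; there)
  import Data.List.Relation.Unary.Any as Any
  open import Data.List.Relation.Unary.Any.Properties using (any⁺; any⁻)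
  import Data.List.Relation.Unary.All as All
  import Data.List.Relation.Unary.All.Properties as All
  open import Data.List.Relation.Unary.Unique.Propositional using (Unique; []; _∷_)
  import Data.List.Relation.Unary.Unique.Propositional.Properties as Unique
  open import Data.List.Relation.Binary.Permutation.Propositional
    using (_↭_; ↭-refl; ↭-prep; ↭-swap; ↭-trans; ↭-sym; ↭⇒↭ₛ)
  open import Data.List.Relation.Binary.Permutation.Propositional.Properties using (∈-resp-↭; ↭-length)
  import Data.List.Relation.Binary.Permutation.Setoid.Properties as Permutationₛ
  open import Relation.Nullary using (¬_; yes; no; does)
  open import Relation.Nullary.Decidable using (T?; dec-true; dec-false)
  open import Relation.Binary.Bundles using (Setoid)
  open import Relation.Binary.PropositionalEquality
  import Relation.Binary.Reasoning.Setoid as SetoidReasoning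

  module _ {A : Set} where

    map⁺-injectiveOn : ∀ {B : Set} {xs : List A} (f : A → B) →
      (∀ {x y} → x ∈ xs → y ∈ xs → f x ≡ f y → x ≡ y) → Unique xs → Unique (map f xs)
    map⁺-injectiveOn f inj [] = []
    map⁺-injectiveOn f inj (x∉xs ∷ u) =
      All.map⁺ (All.tabulate λ y∈xs fx≡fy → All.lookup x∉xs y∈xs (inj (here refl) (there y∈xs) fx≡fy))
      ∷ map⁺-injectiveOn f (λ x∈ y∈ → inj (there x∈) (there y∈)) u

    Unique-resp-↭ : ∀ {xs ys : List A} → xs ↭ ys → Unique xs → Unique ys
    Unique-resp-↭ σ = Permutationₛ.Unique-resp-↭ (setoid A) (↭⇒↭ₛ σ)

    ∈⇒↭∷ : ∀ {x : A} {xs} → x ∈ xs → ∃[ ys ] xs ↭ x ∷ ys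
    ∈⇒↭∷ (here refl) = _ , ↭-refl
    ∈⇒↭∷ {xs = y ∷ _} (there x∈xs) with ys , σ ← ∈⇒↭∷ x∈xs =
      y ∷ ys , ↭-trans (↭-prep y σ) (↭-swap y _ ↭-refl)

    unique-⊆⇒↭ : ∀ {xs ys : List A} → Unique xs → (∀ {z} → z ∈ xs → z ∈ ys) →
      length ys ≤ length xs → xs ↭ ys
    unique-⊆⇒↭ {[]} {[]} _ _ _ = ↭-refl
    unique-⊆⇒↭ {x ∷ xs} (x∉xs ∷ u) xs⊆ys len with ys′ , σ ← ∈⇒↭∷ (xs⊆ys (here refl)) =
      ↭-trans (↭-prep x (unique-⊆⇒↭ u xs⊆ys′ (≤-pred (subst (_≤ suc (length xs)) (↭-length σ) len)))) (↭-sym σ)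
      where
      xs⊆ys′ : ∀ {z} → z ∈ xs → z ∈ ys′
      xs⊆ys′ z∈xs = Any.tail (λ z≡x → All.lookup x∉xs z∈xs (sym z≡x)) (∈-resp-↭ σ (xs⊆ys (there z∈xs)))

  sum-map-+ : ∀ {A : Set} (f g : A → ℕ) xs → sum (map (λ x → f x + g x) xs) ≡ sum (map f xs) + sum (map g xs)
  sum-map-+ f g [] = refl
  sum-map-+ f g (x ∷ xs) rewrite sum-map-+ f g xs = lemma (f x) (g x) (sum (map f xs)) (sum (map g xs))
    where lemma : ∀ a b c d → a + b + (c + d) ≡ a + c + (b + d)
          lemma = solve-∀

  sum-map-*ʳ : ∀ {A : Set} (f : A → ℕ) c xs → sum (map (λ x → f x * c) xs) ≡ sum (map f xs) * c
  sum-map-*ʳ f c [] = refl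
  sum-map-*ʳ f c (x ∷ xs) rewrite sum-map-*ʳ f c xs = sym (*-distribʳ-+ c (f x) (sum (map f xs)))

  product-map-* : ∀ {A : Set} (f g : A → ℕ) xs →
    product (map (λ x → f x * g x) xs) ≡ product (map f xs) * product (map g xs)
  product-map-* f g [] = refl
  product-map-* f g (x ∷ xs) rewrite product-map-* f g xs = lemma (f x) (g x) (product (map f xs)) (product (map g xs))
    where lemma : ∀ a b c d → a * b * (c * d) ≡ a * c * (b * d)
          lemma = solve-∀

  product-map-*ʳ : ∀ c xs → product (map (_* c) xs) ≡ product xs * c ^ length xs
  product-map-*ʳ c [] = refl
  product-map-*ʳ c (x ∷ xs) rewrite product-map-*ʳ c xs = lemma x c (product xs) (c ^ length xs)
    where lemma : ∀ a c b d → a * c * (b * d) ≡ a * b * (c * d)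
          lemma = solve-∀

  product-map-^ : ∀ {A : Set} c (f : A → ℕ) xs → product (map (λ x → c ^ f x) xs) ≡ c ^ sum (map f xs)
  product-map-^ c f [] = refl
  product-map-^ c f (x ∷ xs) = trans (cong (c ^ f x *_) (product-map-^ c f xs)) (sym (^-distribˡ-+-* c (f x) _))

  sum-map-cartesianProduct : ∀ {A B : Set} (f : A × B → ℕ) xs ys →
    sum (map f (cartesianProduct xs ys)) ≡ sum (map (λ x → sum (map (λ y → f (x , y)) ys)) xs)
  sum-map-cartesianProduct f [] ys = refl
  sum-map-cartesianProduct f (x ∷ xs) ys = begin
    sum (map f (map (x ,_) ys ++ cartesianProduct xs ys))
      ≡⟨ cong sum (map-++ f (map (x ,_) ys) _) ⟩
    sum (map f (map (x ,_) ys) ++ map f (cartesianProduct xs ys))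
      ≡⟨ sum-++ (map f (map (x ,_) ys)) _ ⟩
    sum (map f (map (x ,_) ys)) + sum (map f (cartesianProduct xs ys))
      ≡⟨ cong₂ _+_ (cong sum (sym (map-∘ ys))) (sum-map-cartesianProduct f xs ys) ⟩
    sum (map (λ y → f (x , y)) ys) + sum (map (λ x → sum (map (λ y → f (x , y)) ys)) xs) ∎
    where open ≡-Reasoning

  product-map-suc-upTo : ∀ n → product (map suc (upTo n)) ≡ n !
  product-map-suc-upTo zero    = refl
  product-map-suc-upTo (suc n) = begin
    product (map suc (upTo (suc n)))           ≡⟨ cong (product ∘ map suc) (sym (upTo-∷ʳ n)) ⟩
    product (map suc (upTo n ++ n ∷ []))       ≡⟨ cong product (map-++ suc (upTo n) _) ⟩
    product (map suc (upTo n) ++ suc n ∷ [])   ≡⟨ product-++ (map suc (upTo n)) _ ⟩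
    product (map suc (upTo n)) * (suc n * 1)   ≡⟨ cong₂ _*_ (product-map-suc-upTo n) (*-identityʳ (suc n)) ⟩
    n ! * suc n                                ≡⟨ *-comm (n !) (suc n) ⟩
    suc n !                                    ∎
    where open ≡-Reasoning

  +-*2 : ∀ m → m + m ≡ m * 2
  +-*2 = solve-∀

  m+m≡n+n⇒m≡n : ∀ {m n} → m + m ≡ n + n → m ≡ n
  m+m≡n+n⇒m≡n {m} {n} eq = trans (n≡⌊n+n/2⌋ m) (trans (cong ⌊_/2⌋ eq) (sym (n≡⌊n+n/2⌋ n)))

  ^-distribʳ-* : ∀ m n k → (m * n) ^ k ≡ m ^ k * n ^ k
  ^-distribʳ-* m n zero    = refl
  ^-distribʳ-* m n (suc k) rewrite ^-distribʳ-* m n k = lemma m n (m ^ k) (n ^ k)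
    where lemma : ∀ a b c d → a * b * (c * d) ≡ a * c * (b * d)
          lemma = solve-∀

  [h+h]/2≡h : ∀ h → (h + h) / 2 ≡ h
  [h+h]/2≡h h = trans (cong (_/ 2) (+-*2 h)) (m*n/n≡m h 2)

  [1+h+h+1]/2≡1+h : ∀ h → (suc (h + h) + 1) / 2 ≡ suc h
  [1+h+h+1]/2≡1+h h = trans (cong (_/ 2) (lemma h)) (m*n/n≡m (suc h) 2)
    where lemma : ∀ h → suc (h + h) + 1 ≡ suc h * 2
          lemma = solve-∀

  q*[h+h]/2≡q*h : ∀ q h → q * (h + h) / 2 ≡ q * h
  q*[h+h]/2≡q*h q h = trans (cong (λ t → q * t / 2) (+-*2 h)) (trans (cong (_/ 2) (sym (*-assoc q h 2))) (m*n/n≡m (q * h) 2))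

  -- Counting lattice points

  𝟙 : Bool → ℕ
  𝟙 true  = 1
  𝟙 false = 0

  length-filterᵇ : ∀ {A : Set} (b : A → Bool) xs → length (filterᵇ b xs) ≡ sum (map (𝟙 ∘ b) xs)
  length-filterᵇ b [] = refl
  length-filterᵇ b (x ∷ xs) with b x
  ... | true  = cong suc (length-filterᵇ b xs)
  ... | false = length-filterᵇ b xs

  ∑< : ℕ → (ℕ → ℕ) → ℕ
  ∑< n f = sum (map f (upTo n))

  -- Binds looser than _*_ and _/_ but tighter than _+_: ∑[ j < h ] q * j / p
  -- sums the quotients.
  infix 6.5 ∑<
  syntax ∑< n (λ i → e) = ∑[ i < n ] e

  ∑<-front : ∀ n (f : ℕ → ℕ) → ∑< (suc n) f ≡ f 0 + ∑[ i < n ] f (suc i)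
  ∑<-front n f = cong (λ xs → f 0 + sum xs) (trans (cong (map f) (sym (map-upTo suc n))) (sym (map-∘ (upTo n))))

  ∑<-suc : ∀ n (f : ℕ → ℕ) → ∑< (suc n) f ≡ ∑< n f + f n
  ∑<-suc n f = begin
    sum (map f (upTo (suc n)))             ≡⟨ cong (sum ∘ map f) (sym (upTo-∷ʳ n)) ⟩
    sum (map f (upTo n ++ n ∷ []))         ≡⟨ cong sum (map-++ f (upTo n) _) ⟩
    sum (map f (upTo n) ++ f n ∷ [])       ≡⟨ sum-++ (map f (upTo n)) _ ⟩
    ∑< n f + (f n + 0)                     ≡⟨ cong (∑< n f +_) (+-identityʳ (f n)) ⟩
    ∑< n f + f n                           ∎
    where open ≡-Reasoning

  ∑<-cong : ∀ n {f g : ℕ → ℕ} → (∀ i → i < n → f i ≡ g i) → ∑< n f ≡ ∑< n g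
  ∑<-cong zero    f≡g = refl
  ∑<-cong (suc n) {f} {g} f≡g = begin
    ∑< (suc n) f                  ≡⟨ ∑<-front n f ⟩
    f 0 + ∑[ i < n ] f (suc i)    ≡⟨ cong₂ _+_ (f≡g 0 z<s) (∑<-cong n λ i i<n → f≡g (suc i) (s<s i<n)) ⟩
    g 0 + ∑[ i < n ] g (suc i)    ≡⟨ sym (∑<-front n g) ⟩
    ∑< (suc n) g                  ∎
    where open ≡-Reasoning

  ∑<-0 : ∀ n → ∑[ i < n ] 0 ≡ 0
  ∑<-0 zero    = refl
  ∑<-0 (suc n) = trans (∑<-front n (λ _ → 0)) (∑<-0 n)

  ∑<-1 : ∀ n → ∑[ i < n ] 1 ≡ n
  ∑<-1 zero    = refl
  ∑<-1 (suc n) = trans (∑<-front n (λ _ → 1)) (cong suc (∑<-1 n))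

  ∑<-reverse : ∀ n (f : ℕ → ℕ) → ∑[ i < suc n ] f (n ∸ i) ≡ ∑< (suc n) f
  ∑<-reverse zero    f = refl
  ∑<-reverse (suc n) f = begin
    ∑[ i < suc (suc n) ] f (suc n ∸ i)     ≡⟨ ∑<-front (suc n) (λ i → f (suc n ∸ i)) ⟩
    f (suc n) + ∑[ i < suc n ] f (n ∸ i)   ≡⟨ cong (f (suc n) +_) (∑<-reverse n f) ⟩
    f (suc n) + ∑< (suc n) f               ≡⟨ +-comm (f (suc n)) _ ⟩
    ∑< (suc n) f + f (suc n)               ≡⟨ sym (∑<-suc (suc n) f) ⟩
    ∑< (suc (suc n)) f                     ∎
    where open ≡-Reasoning

  ∑<-truncate : ∀ {m n} (f : ℕ → ℕ) → m ≤ n → (∀ i → m ≤ i → f i ≡ 0) → ∑< n f ≡ ∑< m f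
  ∑<-truncate {n = zero}  f z≤n _ = refl
  ∑<-truncate {m} {suc n} f m≤1+n vanish with m≤n⇒m<n∨m≡n m≤1+n
  ... | inj₂ refl    = refl
  ... | inj₁ m≤n = begin
    ∑< (suc n) f      ≡⟨ ∑<-suc n f ⟩
    ∑< n f + f n      ≡⟨ cong₂ _+_ (∑<-truncate f (≤-pred m≤n) vanish) (vanish n (≤-pred m≤n)) ⟩
    ∑< m f + 0        ≡⟨ +-identityʳ _ ⟩
    ∑< m f            ∎
    where open ≡-Reasoning

  ∑<-comm : ∀ m n (f : ℕ → ℕ → ℕ) → ∑[ x < m ] ∑[ y < n ] f x y ≡ ∑[ y < n ] ∑[ x < m ] f x y
  ∑<-comm zero    n f = sym (∑<-0 n)
  ∑<-comm (suc m) n f = begin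
    ∑[ x < suc m ] ∑[ y < n ] f x y
      ≡⟨ ∑<-front m _ ⟩
    ∑[ y < n ] f 0 y + ∑[ x < m ] ∑[ y < n ] f (suc x) y
      ≡⟨ cong (∑[ y < n ] f 0 y +_) (∑<-comm m n (f ∘ suc)) ⟩
    ∑[ y < n ] f 0 y + ∑[ y < n ] ∑[ x < m ] f (suc x) y
      ≡⟨ sym (sum-map-+ (f 0) (λ y → ∑[ x < m ] f (suc x) y) (upTo n)) ⟩
    ∑[ y < n ] (f 0 y + ∑[ x < m ] f (suc x) y)
      ≡⟨ ∑<-cong n (λ y _ → sym (∑<-front m (λ x → f x y))) ⟩
    ∑[ y < n ] ∑[ x < suc m ] f x y ∎
    where open ≡-Reasoning

  𝟙-true : ∀ {b} → T b → 𝟙 b ≡ 1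
  𝟙-true {true} _ = refl

  𝟙-false : ∀ {b} → ¬ T b → 𝟙 b ≡ 0
  𝟙-false {true}  ¬b = ⊥-elim (¬b _)
  𝟙-false {false} _  = refl

  ≤ᵇ-suc : ∀ m n → (suc m ≤ᵇ suc n) ≡ (m ≤ᵇ n)
  ≤ᵇ-suc zero    n = refl
  ≤ᵇ-suc (suc m) n = refl

  ∑<-𝟙[+≡ᵇ] : ∀ {n} A M → M < n → ∑[ z < n ] 𝟙 (A + z ≡ᵇ M) ≡ 𝟙 (A ≤ᵇ M)
  ∑<-𝟙[+≡ᵇ] {suc n} zero    zero    _         =
    trans (∑<-front n (λ z → 𝟙 (z ≡ᵇ 0))) (cong suc (∑<-0 n))
  ∑<-𝟙[+≡ᵇ] {suc n} zero    (suc M) (s<s M<n) =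
    trans (∑<-front n (λ z → 𝟙 (z ≡ᵇ suc M))) (∑<-𝟙[+≡ᵇ] zero M M<n)
  ∑<-𝟙[+≡ᵇ] {n}     (suc A) zero    _         = ∑<-0 n
  ∑<-𝟙[+≡ᵇ] {n}     (suc A) (suc M) 1+M<n     =
    trans (∑<-𝟙[+≡ᵇ] A M (<⇒≤ 1+M<n)) (cong 𝟙 (sym (≤ᵇ-suc A M)))

  module _ (p : ℕ) .{{_ : NonZero p}} where

    ∑<-𝟙[*+≤ᵇ]≡0 : ∀ n A M → M < A → ∑[ x < n ] 𝟙 (p * x + A ≤ᵇ M) ≡ 0
    ∑<-𝟙[*+≤ᵇ]≡0 n A M M<A = trans (∑<-cong n λ x _ → 𝟙-false (λ le → <⇒≱ M<A
      (≤-trans (m≤n+m A (p * x)) (≤ᵇ⇒≤ (p * x + A) M le)))) (∑<-0 n)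

    [m∸n]/p≡1+[m∸[p+n]]/p : ∀ m n → p + n ≤ m → (m ∸ n) / p ≡ suc ((m ∸ (p + n)) / p)
    [m∸n]/p≡1+[m∸[p+n]]/p m n p+n≤m = begin
      (m ∸ n) / p             ≡⟨ m/n≡1+[m∸n]/n (≤-trans (≤-reflexive (sym (m+n∸n≡m p n))) (∸-monoˡ-≤ n p+n≤m)) ⟩
      suc ((m ∸ n ∸ p) / p)   ≡⟨ cong (λ t → suc (t / p)) (trans (∸-+-assoc m n p) (cong (m ∸_) (+-comm n p))) ⟩
      suc ((m ∸ (p + n)) / p) ∎
      where open ≡-Reasoning

    ∑<-𝟙[*+≤ᵇ] : ∀ n A M → A ≤ M → (M ∸ A) / p < n →
      ∑[ x < n ] 𝟙 (p * x + A ≤ᵇ M) ≡ suc ((M ∸ A) / p)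
    ∑<-𝟙[*+≤ᵇ] (suc n) A M A≤M bound = begin
      ∑[ x < suc n ] 𝟙 (p * x + A ≤ᵇ M)
        ≡⟨ ∑<-front n (λ x → 𝟙 (p * x + A ≤ᵇ M)) ⟩
      𝟙 (p * 0 + A ≤ᵇ M) + ∑[ x < n ] 𝟙 (p * suc x + A ≤ᵇ M)
        ≡⟨ cong₂ _+_ (𝟙-true (≤⇒≤ᵇ (subst (_≤ M) (cong (_+ A) (sym (*-zeroʳ p))) A≤M)))
                     (∑<-cong n λ x _ → cong (λ t → 𝟙 (t ≤ᵇ M)) (shift x)) ⟩
      suc (∑[ x < n ] 𝟙 (p * x + (p + A) ≤ᵇ M))
        ≡⟨ cong suc tail-count ⟩
      suc ((M ∸ A) / p) ∎
      where
      open ≡-Reasoning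
      shift : ∀ x → p * suc x + A ≡ p * x + (p + A)
      shift x = trans (cong (_+ A) (*-suc p x)) (lemma p (p * x) A)
        where lemma : ∀ a b c → a + b + c ≡ b + (a + c)
              lemma = solve-∀
      tail-count : ∑[ x < n ] 𝟙 (p * x + (p + A) ≤ᵇ M) ≡ (M ∸ A) / p
      tail-count with p + A ≤? M
      ... | yes p+A≤M = trans (∑<-𝟙[*+≤ᵇ] n (p + A) M p+A≤M
                          (≤-pred (subst (_< suc n) ([m∸n]/p≡1+[m∸[p+n]]/p M A p+A≤M) bound)))
                          (sym ([m∸n]/p≡1+[m∸[p+n]]/p M A p+A≤M))
      ... | no  p+A≰M = trans (∑<-𝟙[*+≤ᵇ]≡0 n (p + A) M (≰⇒> p+A≰M)) (sym (m<n⇒m/n≡0 M∸A<p))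
        where M∸A<p : M ∸ A < p
              M∸A<p = subst (M ∸ A <_) (m+n∸n≡m p A) (∸-monoˡ-< (≰⇒> p+A≰M) A≤M)

  numSolutions≡∑ : ∀ p q M .{{_ : NonZero p}} →
    numSolutions p q M ≡ ∑[ y < suc M ] ∑[ x < suc M ] 𝟙 (p * x + q * y ≤ᵇ M)
  numSolutions≡∑ p q M = begin
    numSolutions p q M
      ≡⟨ length-filterᵇ _ (cartesianProduct X (cartesianProduct X X)) ⟩
    sum (map (𝟙 ∘ solves) (cartesianProduct X (cartesianProduct X X)))
      ≡⟨ sum-map-cartesianProduct (𝟙 ∘ solves) X (cartesianProduct X X) ⟩
    ∑[ x < suc M ] sum (map (λ yz → 𝟙 (solves (x , yz))) (cartesianProduct X X))
      ≡⟨ ∑<-cong (suc M) (λ x _ → sum-map-cartesianProduct (λ yz → 𝟙 (solves (x , yz))) X X) ⟩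
    ∑[ x < suc M ] ∑[ y < suc M ] ∑[ z < suc M ] 𝟙 (p * x + q * y + z ≡ᵇ M)
      ≡⟨ ∑<-cong (suc M) (λ x _ → ∑<-cong (suc M) λ y _ → ∑<-𝟙[+≡ᵇ] (p * x + q * y) M ≤-refl) ⟩
    ∑[ x < suc M ] ∑[ y < suc M ] 𝟙 (p * x + q * y ≤ᵇ M)
      ≡⟨ ∑<-comm (suc M) (suc M) (λ x y → 𝟙 (p * x + q * y ≤ᵇ M)) ⟩
    ∑[ y < suc M ] ∑[ x < suc M ] 𝟙 (p * x + q * y ≤ᵇ M) ∎
    where
    open ≡-Reasoning
    X = upTo (suc M)
    solves : ℕ × (ℕ × ℕ) → Bool
    solves (x , (y , z)) = p * x + q * y + z ≡ᵇ M

  numSolutions-q*h : ∀ p q h .{{_ : NonZero p}} .{{_ : NonZero q}} →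
    numSolutions p q (q * h) ≡ suc h + ∑[ j < h ] (suc j * q) / p
  numSolutions-q*h p q h = begin
    numSolutions p q M
      ≡⟨ numSolutions≡∑ p q M ⟩
    ∑[ y < suc M ] ∑[ x < suc M ] 𝟙 (p * x + q * y ≤ᵇ M)
      ≡⟨ ∑<-truncate _ (s≤s (m≤n*m h q)) (λ y h<y → ∑<-𝟙[*+≤ᵇ]≡0 p (suc M) (q * y) M (*-monoʳ-< q h<y)) ⟩
    ∑[ y < suc h ] ∑[ x < suc M ] 𝟙 (p * x + q * y ≤ᵇ M)
      ≡⟨ ∑<-cong (suc h) (λ y y<1+h → count-x y (≤-pred y<1+h)) ⟩
    ∑[ y < suc h ] suc (q * (h ∸ y) / p)
      ≡⟨ ∑<-reverse h (λ j → suc (q * j / p)) ⟩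
    ∑[ j < suc h ] (1 + q * j / p)
      ≡⟨ sum-map-+ (λ _ → 1) (λ j → q * j / p) (upTo (suc h)) ⟩
    (∑[ j < suc h ] 1) + ∑[ j < suc h ] q * j / p
      ≡⟨ cong₂ _+_ (∑<-1 (suc h)) (∑<-front h (λ j → q * j / p)) ⟩
    suc h + (q * 0 / p + ∑[ j < h ] q * suc j / p)
      ≡⟨ cong (λ t → suc h + (t + ∑[ j < h ] q * suc j / p)) (trans (cong (_/ p) (*-zeroʳ q)) (0/n≡0 p)) ⟩
    suc h + ∑[ j < h ] q * suc j / p
      ≡⟨ cong (suc h +_) (∑<-cong h λ j _ → cong (_/ p) (*-comm q (suc j))) ⟩
    suc h + ∑[ j < h ] (suc j * q) / p ∎
    where
    open ≡-Reasoning
    M = q * h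
    count-x : ∀ y → y ≤ h → ∑[ x < suc M ] 𝟙 (p * x + q * y ≤ᵇ M) ≡ suc (q * (h ∸ y) / p)
    count-x y y≤h = trans
      (∑<-𝟙[*+≤ᵇ] p (suc M) (q * y) M (*-monoʳ-≤ q y≤h) (s≤s (≤-trans (m/n≤m (M ∸ q * y) p) (m∸n≤m M (q * y)))))
      (cong (λ t → suc (t / p)) (sym (*-distribˡ-∸ q h y)))

  -- Congruences

  -- A record rather than a synonym for a % n ≡ b % n, so that a, b and n can be
  -- recovered by unification.
  infix 4 _≡_mod_
  record _≡_mod_ (a b n : ℕ) .{{_ : NonZero n}} : Set where
    constructor mk≡mod
    field %-≡ : a % n ≡ b % n
  open _≡_mod_

  module _ {n : ℕ} .{{_ : NonZero n}} where

    ≡-mod-refl : ∀ {a} → a ≡ a mod n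
    ≡-mod-refl = mk≡mod refl

    ≡-mod-sym : ∀ {a b} → a ≡ b mod n → b ≡ a mod n
    ≡-mod-sym (mk≡mod a≡b) = mk≡mod (sym a≡b)

    ≡-mod-trans : ∀ {a b c} → a ≡ b mod n → b ≡ c mod n → a ≡ c mod n
    ≡-mod-trans (mk≡mod a≡b) (mk≡mod b≡c) = mk≡mod (trans a≡b b≡c)

    ≡-mod-setoid : Setoid 0ℓ 0ℓ
    ≡-mod-setoid = record
      { Carrier       = ℕ
      ; _≈_           = λ a b → a ≡ b mod n
      ; isEquivalence = record { refl = ≡-mod-refl ; sym = ≡-mod-sym ; trans = ≡-mod-trans }
      }

    %-≡-mod : ∀ a → a % n ≡ a mod n
    %-≡-mod a = mk≡mod (m%n%n≡m%n a n)

    n≡0-mod : n ≡ 0 mod n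
    n≡0-mod = mk≡mod (trans (n%n≡0 n) (sym (m<n⇒m%n≡m (>-nonZero⁻¹ n))))

    m*n≡0-mod : ∀ m → m * n ≡ 0 mod n
    m*n≡0-mod m = mk≡mod (trans (m*n%n≡0 m n) (sym (m<n⇒m%n≡m (>-nonZero⁻¹ n))))

    ≡0-mod⇒∣ : ∀ {a} → a ≡ 0 mod n → n ∣ a
    ≡0-mod⇒∣ {a} (mk≡mod a≡0) = m%n≡0⇒n∣m a n (trans a≡0 (m<n⇒m%n≡m (>-nonZero⁻¹ n)))

    +-cong-mod : ∀ {a b c d} → a ≡ b mod n → c ≡ d mod n → a + c ≡ b + d mod n
    +-cong-mod {a} {b} {c} {d} (mk≡mod a≡b) (mk≡mod c≡d) = mk≡mod (begin
      (a + c) % n           ≡⟨ %-distribˡ-+ a c n ⟩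
      (a % n + c % n) % n   ≡⟨ cong₂ (λ u v → (u + v) % n) a≡b c≡d ⟩
      (b % n + d % n) % n   ≡⟨ %-distribˡ-+ b d n ⟨
      (b + d) % n           ∎)
      where open ≡-Reasoning

    *-cong-mod : ∀ {a b c d} → a ≡ b mod n → c ≡ d mod n → a * c ≡ b * d mod n
    *-cong-mod {a} {b} {c} {d} (mk≡mod a≡b) (mk≡mod c≡d) = mk≡mod (begin
      (a * c) % n           ≡⟨ %-distribˡ-* a c n ⟩
      (a % n * (c % n)) % n ≡⟨ cong₂ (λ u v → (u * v) % n) a≡b c≡d ⟩
      (b % n * (d % n)) % n ≡⟨ %-distribˡ-* b d n ⟨
      (b * d) % n           ∎)
      where open ≡-Reasoning

    ^-cong-mod : ∀ {a b} m → a ≡ b mod n → a ^ m ≡ b ^ m mod n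
    ^-cong-mod zero    a≡b = ≡-mod-refl
    ^-cong-mod (suc m) a≡b = *-cong-mod a≡b (^-cong-mod m a≡b)

    product-cong-mod : ∀ {A : Set} (f g : A → ℕ) xs → (∀ {x} → x ∈ xs → f x ≡ g x mod n) →
      product (map f xs) ≡ product (map g xs) mod n
    product-cong-mod f g []       _   = ≡-mod-refl
    product-cong-mod f g (x ∷ xs) f≡g = *-cong-mod (f≡g (here refl)) (product-cong-mod f g xs (f≡g ∘ there))

    ∣⇒≡0-mod : ∀ {a} → n ∣ a → a ≡ 0 mod n
    ∣⇒≡0-mod {a} n∣a = mk≡mod (trans (n∣m⇒m%n≡0 a n n∣a) (sym (m<n⇒m%n≡m (>-nonZero⁻¹ n))))

    ≡-mod⇒∣∸ : ∀ {a b} → a ≡ b mod n → n ∣ b ∸ a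
    ≡-mod⇒∣∸ {a} {b} (mk≡mod a≡b) = divides (b / n ∸ a / n) (begin
      b ∸ a                                      ≡⟨ cong₂ _∸_ (m≡m%n+[m/n]*n b n) (m≡m%n+[m/n]*n a n) ⟩
      (b % n + b / n * n) ∸ (a % n + a / n * n)  ≡⟨ cong (λ t → (t + b / n * n) ∸ (a % n + a / n * n)) (sym a≡b) ⟩
      (a % n + b / n * n) ∸ (a % n + a / n * n)  ≡⟨ [m+n]∸[m+o]≡n∸o (a % n) _ _ ⟩
      b / n * n ∸ a / n * n                      ≡⟨ *-distribʳ-∸ n (b / n) (a / n) ⟨
      (b / n ∸ a / n) * n                        ∎)
      where open ≡-Reasoning

    ∣∸⇒≡-mod : ∀ {a b} → n ∣ b ∸ a → n ∣ a ∸ b → a ≡ b mod n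
    ∣∸⇒≡-mod {a} {b} n∣b∸a n∣a∸b with ≤-total a b
    ... | inj₁ a≤b = mk≡mod (trans (sym (%-remove-+ʳ a n∣b∸a)) (cong (_% n) (m+[n∸m]≡n a≤b)))
    ... | inj₂ b≤a = mk≡mod (sym (trans (sym (%-remove-+ʳ b n∣a∸b)) (cong (_% n) (m+[n∸m]≡n b≤a))))

    +-cancelˡ-mod : ∀ c {a b} → c + a ≡ c + b mod n → a ≡ b mod n
    +-cancelˡ-mod c {a} {b} c+a≡c+b = ∣∸⇒≡-mod
      (subst (n ∣_) ([m+n]∸[m+o]≡n∸o c b a) (≡-mod⇒∣∸ c+a≡c+b))
      (subst (n ∣_) ([m+n]∸[m+o]≡n∸o c a b) (≡-mod⇒∣∸ (≡-mod-sym c+a≡c+b)))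

    *-comm-mod : ∀ a b {c} → a * b ≡ c mod n → b * a ≡ c mod n
    *-comm-mod a b {c} = subst (λ t → t ≡ c mod n) (*-comm a b)

    ≡-mod⇒≡ : ∀ {a b} → a < n → b < n → a ≡ b mod n → a ≡ b
    ≡-mod⇒≡ a<n b<n (mk≡mod a≡b) = trans (sym (m<n⇒m%n≡m a<n)) (trans a≡b (m<n⇒m%n≡m b<n))

  module ≡-mod-Reasoning (n : ℕ) .{{_ : NonZero n}} = SetoidReasoning (≡-mod-setoid {n})

  *-oddʳ : ∀ {a} b → a ≡ 1 mod 2 → b * a ≡ b mod 2
  *-oddʳ {a} b a≡1 = ≡-mod-trans (*-cong-mod (≡-mod-refl {a = b}) a≡1) (mk≡mod (cong (_% 2) (*-identityʳ b)))

  m+n≡0⇒m≡n-mod2 : ∀ {m n} → m + n ≡ 0 mod 2 → m ≡ n mod 2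
  m+n≡0⇒m≡n-mod2 {m} {n} m+n≡0 = begin
    m            ≡⟨ +-identityʳ m ⟨
    m + 0        ≈⟨ +-cong-mod ≡-mod-refl (m*n≡0-mod n) ⟨
    m + n * 2    ≡⟨ lemma m n ⟩
    m + n + n    ≈⟨ +-cong-mod m+n≡0 ≡-mod-refl ⟩
    n            ∎
    where
    open ≡-mod-Reasoning 2
    lemma : ∀ m n → m + n * 2 ≡ m + n + n
    lemma = solve-∀

  %2-cases : ∀ n → n % 2 ≡ 0 ⊎ n % 2 ≡ 1
  %2-cases 0             = inj₁ refl
  %2-cases 1             = inj₂ refl
  %2-cases (suc (suc n)) = %2-cases n

  2∤⇒≡1+h+h : ∀ {n} → 2 ∤ n → ∃[ h ] n ≡ suc (h + h)
  2∤⇒≡1+h+h {n} 2∤n with %2-cases n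
  ... | inj₁ n%2≡0 = ⊥-elim (2∤n (m%n≡0⇒n∣m n 2 n%2≡0))
  ... | inj₂ n%2≡1 = n / 2 , (begin
    n                    ≡⟨ m≡m%n+[m/n]*n n 2 ⟩
    n % 2 + n / 2 * 2    ≡⟨ cong₂ _+_ n%2≡1 (sym (+-*2 (n / 2))) ⟩
    suc (n / 2 + n / 2)  ∎)
    where open ≡-Reasoning

  1+h+h≡1-mod2 : ∀ h → suc (h + h) ≡ 1 mod 2
  1+h+h≡1-mod2 h = +-cong-mod {a = 1} ≡-mod-refl (subst (_≡ 0 mod 2) (sym (+-*2 h)) (m*n≡0-mod h))

  2∤⇒≡1-mod2 : ∀ {n} → 2 ∤ n → n ≡ 1 mod 2
  2∤⇒≡1-mod2 2∤n with h , refl ← 2∤⇒≡1+h+h 2∤n = 1+h+h≡1-mod2 h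

  prime∤prime : ∀ {p q} → Prime p → Prime q → p ≢ q → p ∤ q
  prime∤prime {p} p-prime q-prime p≢q p∣q with prime⇒irreducible q-prime p∣q
  ... | inj₁ p≡1 = ¬prime[1] (subst Prime p≡1 p-prime)
  ... | inj₂ p≡q = p≢q p≡q

  module _ {p : ℕ} .{{_ : NonZero p}} (prime : Prime p) where

    ∤-* : ∀ {a b} → p ∤ a → p ∤ b → p ∤ a * b
    ∤-* {a} {b} p∤a p∤b p∣ab with euclidsLemma a b prime p∣ab
    ... | inj₁ p∣a = p∤a p∣a
    ... | inj₂ p∣b = p∤b p∣b

    ∤-product : ∀ xs → (∀ {x} → x ∈ xs → p ∤ x) → p ∤ product xs
    ∤-product []       _   p∣1 = ¬prime[1] (subst Prime (∣1⇒≡1 p∣1) prime)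
    ∤-product (x ∷ xs) p∤xs = ∤-* (p∤xs (here refl)) (∤-product xs (p∤xs ∘ there))

    *-cancelʳ-mod : ∀ {a b c} → p ∤ c → a * c ≡ b * c mod p → a ≡ b mod p
    *-cancelʳ-mod {a} {b} {c} p∤c ac≡bc =
      ∣∸⇒≡-mod (cancel b a (≡-mod⇒∣∸ ac≡bc)) (cancel a b (≡-mod⇒∣∸ (≡-mod-sym ac≡bc)))
      where
      cancel : ∀ x y → p ∣ x * c ∸ y * c → p ∣ x ∸ y
      cancel x y p∣ with euclidsLemma (x ∸ y) c prime (subst (p ∣_) (sym (*-distribʳ-∸ c x y)) p∣)
      ... | inj₁ p∣x∸y = p∣x∸y
      ... | inj₂ p∣c   = ⊥-elim (p∤c p∣c)

    *-cancelˡ-mod : ∀ {a b c} → p ∤ c → c * a ≡ c * b mod p → a ≡ b mod p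
    *-cancelˡ-mod {a} {b} {c} p∤c ca≡cb =
      *-cancelʳ-mod p∤c (subst₂ (λ u v → u ≡ v mod p) (*-comm c a) (*-comm c b) ca≡cb)


    module _ {c : ℕ} (p∤c : p ∤ c) where

      partner-∤ : ∀ {x y} → x * y ≡ c mod p → p ∤ x
      partner-∤ {x} {y} xy≡c p∣x =
        p∤c (≡0-mod⇒∣ (≡-mod-trans (≡-mod-sym xy≡c) (∣⇒≡0-mod (∣m⇒∣m*n y p∣x))))

      partner-unique : ∀ {x y y′} → x * y ≡ c mod p → x * y′ ≡ c mod p → y < p → y′ < p → y ≡ y′
      partner-unique {x} {y} {y′} xy≡c xy′≡c y<p y′<p = ≡-mod⇒≡ y<p y′<p (*-cancelʳ-mod (partner-∤ xy≡c)
        (≡-mod-trans (*-comm-mod x y xy≡c) (≡-mod-sym (*-comm-mod x y′ xy′≡c))))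

      record Paired (xs : List ℕ) : Set where
        field
          unique    : Unique xs
          bounded   : ∀ {x} → x ∈ xs → x < p
          partnered : ∀ {x} → x ∈ xs → ∃[ y ] y ∈ xs × x * y ≡ c mod p
          unpaired  : ∀ {x} → x ∈ xs → ¬ x * x ≡ c mod p
      open Paired

      Paired-resp-↭ : ∀ {xs ys} → xs ↭ ys → Paired xs → Paired ys
      Paired-resp-↭ σ P = record
        { unique    = Unique-resp-↭ σ (unique P)
        ; bounded   = bounded P ∘ ∈-resp-↭ (↭-sym σ)
        ; partnered = λ x∈ys → let y , y∈xs , xy≡c = partnered P (∈-resp-↭ (↭-sym σ) x∈ys)
                               in y , ∈-resp-↭ σ y∈xs , xy≡c
        ; unpaired  = unpaired P ∘ ∈-resp-↭ (↭-sym σ)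
        }

      Paired-drop : ∀ {x y zs} → x * y ≡ c mod p → Paired (x ∷ y ∷ zs) → Paired zs
      Paired-drop {x} {y} {zs} xy≡c P with unique P
      ... | (_ All.∷ x∉zs) ∷ y∉zs ∷ zs-unique = record
        { unique    = zs-unique
        ; bounded   = bounded P ∘ there ∘ there
        ; partnered = partnered-zs
        ; unpaired  = unpaired P ∘ there ∘ there
        }
        where
        partnered-zs : ∀ {z} → z ∈ zs → ∃[ w ] w ∈ zs × z * w ≡ c mod p
        partnered-zs {z} z∈zs with partnered P (there (there z∈zs))
        ... | w , here w≡x , zw≡c = ⊥-elim (All.lookup y∉zs z∈zs (partner-unique {x = x} xy≡c
                (*-comm-mod z x (subst (λ t → z * t ≡ c mod p) w≡x zw≡c))
                (bounded P (there (here refl))) (bounded P (there (there z∈zs)))))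
        ... | w , there (here w≡y) , zw≡c = ⊥-elim (All.lookup x∉zs z∈zs (partner-unique {x = y} (*-comm-mod x y xy≡c)
                (*-comm-mod z y (subst (λ t → z * t ≡ c mod p) w≡y zw≡c))
                (bounded P (here refl)) (bounded P (there (there z∈zs)))))
        ... | w , there (there w∈zs) , zw≡c = w , w∈zs , zw≡c

      product-paired : ∀ {xs} → Paired xs → ∃[ m ] (length xs ≡ m + m) × product xs ≡ c ^ m mod p
      product-paired {xs} = go (length xs) ≤-refl
        where
        go : ∀ n {xs} → length xs ≤ n → Paired xs → ∃[ m ] (length xs ≡ m + m) × product xs ≡ c ^ m mod p
        go _       {[]}     _            _ = 0 , refl , ≡-mod-refl
        go (suc n) {x ∷ xs} (s≤s |xs|≤n) P
          with y , y∈ , xy≡c ← partnered P (here refl)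
          with zs , σ ← ∈⇒↭∷ (Any.tail (λ y≡x → unpaired P (here refl) (subst (λ t → x * t ≡ c mod p) y≡x xy≡c))
                                       y∈)
          with m , |zs|≡m+m , Πzs≡cᵐ ← go n (≤-trans (n≤1+n _) (subst (_≤ n) (↭-length σ) |xs|≤n))
                                           (Paired-drop xy≡c (Paired-resp-↭ (↭-prep x σ) P))
          = suc m , cong suc (trans (↭-length σ) (trans (cong suc |zs|≡m+m) (sym (+-suc m m)))) , Π≡cᵐ⁺¹
          where
          open ≡-mod-Reasoning p
          Π≡cᵐ⁺¹ : x * product xs ≡ c * c ^ m mod p
          Π≡cᵐ⁺¹ = begin
            x * product xs          ≡⟨ cong (x *_) (product-↭ σ) ⟩
            x * (y * product zs)    ≡⟨ *-assoc x y _ ⟨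
            x * y * product zs      ≈⟨ *-cong-mod xy≡c Πzs≡cᵐ ⟩
            c * c ^ m               ∎

    *-permutes-residues : ∀ {x} → p ∤ x → map (λ y → x * y % p) (upTo p) ↭ upTo p
    *-permutes-residues {x} p∤x = unique-⊆⇒↭
      (map⁺-injectiveOn _ (λ y∈ y′∈ eq → ≡-mod⇒≡ (∈-upTo⁻ y∈) (∈-upTo⁻ y′∈) (*-cancelˡ-mod p∤x (mk≡mod eq)))
                          (Unique.upTo⁺ p))
      (λ z∈ → let y , _ , z≡ = ∈-map⁻ _ z∈ in subst (_∈ upTo p) (sym z≡) (∈-upTo⁺ (m%n<n (x * y) p)))
      (≤-reflexive (sym (length-map _ (upTo p))))

    ∃-partner : ∀ {x} c → p ∤ x → ∃[ y ] y < p × x * y ≡ c mod p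
    ∃-partner {x} c p∤x
      with y , y∈ , c%p≡xy%p ← ∈-map⁻ (λ y → x * y % p)
                                 (∈-resp-↭ (↭-sym (*-permutes-residues p∤x)) (∈-upTo⁺ (m%n<n c p)))
      = y , ∈-upTo⁻ y∈ , mk≡mod (sym c%p≡xy%p)

  -1ℤ^n≡-1ℤ^[n%2] : ∀ n → -1ℤ ^ℤ n ≡ -1ℤ ^ℤ (n % 2)
  -1ℤ^n≡-1ℤ^[n%2] 0             = refl
  -1ℤ^n≡-1ℤ^[n%2] 1             = refl
  -1ℤ^n≡-1ℤ^[n%2] (suc (suc n)) =
    trans (sym (ℤ.*-assoc -1ℤ -1ℤ _)) (trans (ℤ.*-identityˡ _) (-1ℤ^n≡-1ℤ^[n%2] n))

  -1ℤ^even : ∀ {n} → n % 2 ≡ 0 → -1ℤ ^ℤ n ≡ 1ℤ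
  -1ℤ^even {n} n%2≡0 = trans (-1ℤ^n≡-1ℤ^[n%2] n) (cong (-1ℤ ^ℤ_) n%2≡0)

  -1ℤ^odd : ∀ {n} → n % 2 ≡ 1 → -1ℤ ^ℤ n ≡ -1ℤ
  -1ℤ^odd {n} n%2≡1 = trans (-1ℤ^n≡-1ℤ^[n%2] n) (cong (-1ℤ ^ℤ_) n%2≡1)

  if-true : ∀ {A : Set} {b} {x y : A} → T b → (if b then x else y) ≡ x
  if-true {b = true} _ = refl

  if-false : ∀ {A : Set} {b} {x y : A} → ¬ T b → (if b then x else y) ≡ y
  if-false {b = true}  ¬b = ⊥-elim (¬b _)
  if-false {b = false} _  = refl

  _IsSquareMod_ : ℕ → (n : ℕ) → .{{NonZero n}} → Set
  q IsSquareMod n = ∃[ x ] x * x ≡ q mod n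

  module _ {q k : ℕ} (p∤q : suc k ∤ q) where

    private
      isRoot : ℕ → Bool
      isRoot x = x * x % suc k ≡ᵇ q % suc k

      q%p≢0 : ¬ T (q % suc k ≡ᵇ 0)
      q%p≢0 t = p∤q (m%n≡0⇒n∣m q (suc k) (≡ᵇ⇒≡ _ _ t))

    legendre-cases : (q IsSquareMod suc k × legendre q (suc k) ≡ 1ℤ)
                   ⊎ (¬ q IsSquareMod suc k × legendre q (suc k) ≡ -1ℤ)
    legendre-cases with T? (any isRoot (upTo (suc k)))
    ... | yes root = inj₁ (square , trans (if-false q%p≢0) (if-true root))
      where
      square : q IsSquareMod suc k
      square with x , xx≡q ← Any.satisfied (any⁻ isRoot (upTo (suc k)) root) = x , mk≡mod (≡ᵇ⇒≡ _ _ xx≡q)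
    ... | no ¬root = inj₂ (nonsquare , trans (if-false q%p≢0) (if-false ¬root))
      where
      nonsquare : ¬ q IsSquareMod suc k
      nonsquare (x , xx≡q) = ¬root (any⁺ isRoot (lose (∈-upTo⁺ (m%n<n x (suc k))) (≡⇒≡ᵇ _ _ (%-≡ x%p-root))))
        where
        x%p-root : x % suc k * (x % suc k) ≡ q mod suc k
        x%p-root = ≡-mod-trans (*-cong-mod (%-≡-mod x) (%-≡-mod x)) xx≡q

  -- Odd primes

  module OddPrime (h : ℕ) (prime : Prime (suc (h + h))) where

    -- p-1 plays the role of -1 modulo p.
    p-1 p : ℕ
    p-1 = h + h
    p   = suc p-1

    0<h : 0 < h
    0<h = n≢0⇒n>0 λ h≡0 → ¬prime[1] (subst (λ t → Prime (suc (t + t))) h≡0 prime)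

    0<x<p⇒p∤x : ∀ {x} → 0 < x → x < p → p ∤ x
    0<x<p⇒p∤x {suc x} _ x<p p∣x = <⇒≱ x<p (∣⇒≤ p∣x)

    p-1*p-1≡1 : p-1 * p-1 ≡ 1 mod p
    p-1*p-1≡1 = +-cancelˡ-mod p-1 (begin
      p-1 + p-1 * p-1  ≡⟨ *-suc p-1 p-1 ⟨
      p-1 * p          ≈⟨ m*n≡0-mod p-1 ⟩
      0                ≈⟨ n≡0-mod ⟨
      p                ≡⟨ +-comm 1 p-1 ⟩
      p-1 + 1          ∎)
      where open ≡-mod-Reasoning p

    p-1^n≡p-1^[n%2] : ∀ n → p-1 ^ n ≡ p-1 ^ (n % 2) mod p
    p-1^n≡p-1^[n%2] 0             = ≡-mod-refl
    p-1^n≡p-1^[n%2] 1             = ≡-mod-refl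
    p-1^n≡p-1^[n%2] (suc (suc n)) = begin
      p-1 * (p-1 * p-1 ^ n)  ≡⟨ *-assoc p-1 p-1 _ ⟨
      p-1 * p-1 * p-1 ^ n    ≈⟨ *-cong-mod p-1*p-1≡1 ≡-mod-refl ⟩
      1 * p-1 ^ n            ≡⟨ *-identityˡ _ ⟩
      p-1 ^ n                ≈⟨ p-1^n≡p-1^[n%2] n ⟩
      p-1 ^ (n % 2)          ∎
      where open ≡-mod-Reasoning p

    p-odd : p ≡ 1 mod 2
    p-odd = 1+h+h≡1-mod2 h

    half : List ℕ
    half = map suc (upTo h)

    sum-half : ∀ f → sum (map f half) ≡ ∑[ j < h ] f (suc j)
    sum-half f = cong sum (sym (map-∘ (upTo h)))

    ∈-half⁻ : ∀ {i} → i ∈ half → 0 < i × i ≤ h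
    ∈-half⁻ i∈half with j , j∈ , refl ← ∈-map⁻ suc i∈half = z<s , ∈-upTo⁻ j∈

    ∈-half⁺ : ∀ {i} → 0 < i → i ≤ h → i ∈ half
    ∈-half⁺ {suc j} _ j<h = ∈-map⁺ suc (∈-upTo⁺ j<h)

    ∈-half⇒<p : ∀ {i} → i ∈ half → i < p
    ∈-half⇒<p i∈half = s≤s (≤-trans (proj₂ (∈-half⁻ i∈half)) (m≤m+n h h))

    ∈-half⇒p∤ : ∀ {i} → i ∈ half → p ∤ i
    ∈-half⇒p∤ i∈half = 0<x<p⇒p∤x (proj₁ (∈-half⁻ i∈half)) (∈-half⇒<p i∈half)

    half-unique : Unique half
    half-unique = Unique.map⁺ suc-injective (Unique.upTo⁺ h)

    length-half : length half ≡ h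
    length-half = trans (length-map suc (upTo h)) (length-upTo h)

    module Gauss (a : ℕ) (p∤a : p ∤ a) where

      r : ℕ → ℕ
      r i = i * a % p

      -- ± s i is the absolutely least residue of i a, the sign being - when upper i.
      upper : ℕ → Bool
      upper i = does (h <? r i)

      s : ℕ → ℕ
      s i = if upper i then p ∸ r i else r i

      μ : ℕ
      μ = sum (map (𝟙 ∘ upper) half)

      data Side (i : ℕ) : Set where
        inUpper : h < r i → upper i ≡ true  → s i ≡ p ∸ r i → Side i
        inLower : r i ≤ h → upper i ≡ false → s i ≡ r i     → Side i

      side : ∀ i → Side i
      side i with h <? r i
      ... | yes h<r = inUpper h<r eq (cong (λ b → if b then p ∸ r i else r i) eq)
        where eq = dec-true (h <? r i) h<r
      ... | no  h≮r = inLower (≮⇒≥ h≮r) eq (cong (λ b → if b then p ∸ r i else r i) eq)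
        where eq = dec-false (h <? r i) h≮r

      r<p : ∀ i → r i < p
      r<p i = m%n<n (i * a) p

      r+[p∸r]≡p : ∀ i → r i + (p ∸ r i) ≡ p
      r+[p∸r]≡p i = m+[n∸m]≡n (<⇒≤ (r<p i))

      0<r : ∀ {i} → i ∈ half → 0 < r i
      0<r {i} i∈half = n≢0⇒n>0 λ rᵢ≡0 → ∤-* prime (∈-half⇒p∤ i∈half) p∤a (m%n≡0⇒n∣m (i * a) p rᵢ≡0)

      r-injective : ∀ {i j} → i ∈ half → j ∈ half → r i ≡ r j → i ≡ j
      r-injective i∈half j∈half rᵢ≡rⱼ =
        ≡-mod⇒≡ (∈-half⇒<p i∈half) (∈-half⇒<p j∈half) (*-cancelʳ-mod prime p∤a (mk≡mod rᵢ≡rⱼ))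

      r+r≢p : ∀ {i j} → i ∈ half → j ∈ half → r i + r j ≢ p
      r+r≢p {i} {j} i∈half j∈half rᵢ+rⱼ≡p with euclidsLemma (i + j) a prime (≡0-mod⇒∣ [i+j]a≡0)
        where
        [i+j]a≡0 : (i + j) * a ≡ 0 mod p
        [i+j]a≡0 = begin
          (i + j) * a    ≡⟨ *-distribʳ-+ a i j ⟩
          i * a + j * a  ≈⟨ +-cong-mod (%-≡-mod (i * a)) (%-≡-mod (j * a)) ⟨
          r i + r j      ≡⟨ rᵢ+rⱼ≡p ⟩
          p              ≈⟨ n≡0-mod ⟩
          0              ∎
          where open ≡-mod-Reasoning p
      ... | inj₂ p∣a   = p∤a p∣a
      ... | inj₁ p∣i+j = 0<x<p⇒p∤x (≤-trans (proj₁ (∈-half⁻ i∈half)) (m≤m+n i j))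
                            (s≤s (+-mono-≤ (proj₂ (∈-half⁻ i∈half)) (proj₂ (∈-half⁻ j∈half)))) p∣i+j

      s∈half : ∀ {i} → i ∈ half → s i ∈ half
      s∈half {i} i∈half with side i
      ... | inUpper h<r _ sᵢ≡ = subst (_∈ half) (sym sᵢ≡) (∈-half⁺ (m<n⇒0<n∸m (r<p i))
              (≤-trans (∸-monoʳ-≤ p h<r) (≤-reflexive (m+n∸m≡n h h))))
      ... | inLower r≤h _ sᵢ≡ = subst (_∈ half) (sym sᵢ≡) (∈-half⁺ (0<r i∈half) r≤h)

      s-injective : ∀ {i j} → i ∈ half → j ∈ half → s i ≡ s j → i ≡ j
      s-injective {i} {j} i∈half j∈half sᵢ≡sⱼ with side i | side j
      ... | inUpper _ _ sᵢ≡ | inUpper _ _ sⱼ≡ = r-injective i∈half j∈half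
            (∸-cancelˡ-≡ (<⇒≤ (r<p i)) (<⇒≤ (r<p j)) (trans (sym sᵢ≡) (trans sᵢ≡sⱼ sⱼ≡)))
      ... | inLower _ _ sᵢ≡ | inLower _ _ sⱼ≡ = r-injective i∈half j∈half (trans (sym sᵢ≡) (trans sᵢ≡sⱼ sⱼ≡))
      ... | inUpper _ _ sᵢ≡ | inLower _ _ sⱼ≡ = ⊥-elim (r+r≢p i∈half j∈half
            (trans (cong (r i +_) (trans (sym sⱼ≡) (trans (sym sᵢ≡sⱼ) sᵢ≡))) (r+[p∸r]≡p i)))
      ... | inLower _ _ sᵢ≡ | inUpper _ _ sⱼ≡ = ⊥-elim (r+r≢p j∈half i∈half
            (trans (cong (r j +_) (trans (sym sᵢ≡) (trans sᵢ≡sⱼ sⱼ≡))) (r+[p∸r]≡p j)))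

      s-perm : map s half ↭ half
      s-perm = unique-⊆⇒↭ (map⁺-injectiveOn s s-injective half-unique) s⊆half
        (≤-reflexive (sym (length-map s half)))
        where
        s⊆half : ∀ {z} → z ∈ map s half → z ∈ half
        s⊆half z∈ with i , i∈half , refl ← ∈-map⁻ s z∈ = s∈half i∈half

      i*a≡±s : ∀ i → i * a ≡ p-1 ^ 𝟙 (upper i) * s i mod p
      i*a≡±s i with side i
      ... | inLower _ upperᵢ sᵢ≡ rewrite upperᵢ | sᵢ≡ = begin
        i * a          ≈⟨ %-≡-mod (i * a) ⟨
        r i            ≡⟨ *-identityˡ (r i) ⟨
        1 * r i        ∎
        where open ≡-mod-Reasoning p
      ... | inUpper _ upperᵢ sᵢ≡ rewrite upperᵢ | sᵢ≡ = begin
        i * a          ≈⟨ %-≡-mod (i * a) ⟨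
        r i            ≈⟨ +-cancelˡ-mod t t+r≡t+p-1*t ⟩
        p-1 * t        ≡⟨ cong (_* t) (*-identityʳ p-1) ⟨
        p-1 * 1 * t    ∎
        where
        open ≡-mod-Reasoning p
        t = p ∸ r i
        t+r≡t+p-1*t : t + r i ≡ t + p-1 * t mod p
        t+r≡t+p-1*t = begin
          t + r i      ≡⟨ trans (+-comm t (r i)) (r+[p∸r]≡p i) ⟩
          p            ≈⟨ n≡0-mod ⟩
          0            ≈⟨ m*n≡0-mod t ⟨
          t * p        ≡⟨ *-comm t p ⟩
          t + p-1 * t  ∎

      gauss : a ^ h ≡ p-1 ^ μ mod p
      gauss = *-cancelʳ-mod prime (∤-product prime half ∈-half⇒p∤) (begin
        a ^ h * product half
          ≡⟨ trans (*-comm (a ^ h) _) (cong (λ n → product half * a ^ n) (sym length-half)) ⟩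
        product half * a ^ length half
          ≡⟨ product-map-*ʳ a half ⟨
        product (map (_* a) half)
          ≈⟨ product-cong-mod (_* a) (λ i → p-1 ^ 𝟙 (upper i) * s i) half (λ {i} _ → i*a≡±s i) ⟩
        product (map (λ i → p-1 ^ 𝟙 (upper i) * s i) half)
          ≡⟨ product-map-* (λ i → p-1 ^ 𝟙 (upper i)) s half ⟩
        product (map (λ i → p-1 ^ 𝟙 (upper i)) half) * product (map s half)
          ≡⟨ cong₂ _*_ (product-map-^ p-1 (𝟙 ∘ upper) half) (product-↭ s-perm) ⟩
        p-1 ^ μ * product half ∎)
        where open ≡-mod-Reasoning p

      S : ℕ
      S = ∑[ j < h ] (suc j * a) / p

      r+2s≡s+p : ∀ i → r i + 𝟙 (upper i) * s i * 2 ≡ s i + 𝟙 (upper i) * p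
      r+2s≡s+p i with side i
      ... | inLower _ upperᵢ sᵢ≡ rewrite upperᵢ | sᵢ≡ = refl
      ... | inUpper _ upperᵢ sᵢ≡ rewrite upperᵢ | sᵢ≡ =
        trans (lemma (r i) (p ∸ r i)) (cong (λ x → p ∸ r i + 1 * x) (r+[p∸r]≡p i))
        where lemma : ∀ r t → r + 1 * t * 2 ≡ t + 1 * (r + t)
              lemma = solve-∀

      eisenstein-identity :
        sum half * a + sum (map (λ i → 𝟙 (upper i) * s i) half) * 2 ≡ S * p + (sum half + μ * p)
      eisenstein-identity = begin
        sum half * a + X * 2
          ≡⟨ cong (λ xs → sum xs * a + X * 2) (map-id half) ⟨
        sum (map (λ i → i) half) * a + X * 2
          ≡⟨ cong (_+ X * 2) (sum-map-*ʳ (λ i → i) a half) ⟨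
        sum (map (_* a) half) + X * 2
          ≡⟨ cong (λ xs → sum xs + X * 2) (map-cong (λ i → m≡m%n+[m/n]*n (i * a) p) half) ⟩
        sum (map (λ i → r i + i * a / p * p) half) + X * 2
          ≡⟨ cong (_+ X * 2) (sum-map-+ r (λ i → i * a / p * p) half) ⟩
        sum (map r half) + sum (map (λ i → i * a / p * p) half) + X * 2
          ≡⟨ cong (λ t → sum (map r half) + t + X * 2)
                  (trans (sum-map-*ʳ (λ i → i * a / p) p half) (cong (_* p) (sum-half _))) ⟩
        sum (map r half) + S * p + X * 2
          ≡⟨ lemma (sum (map r half)) (S * p) (X * 2) ⟩
        S * p + (sum (map r half) + X * 2)
          ≡⟨ cong (λ t → S * p + (sum (map r half) + t)) (sum-map-*ʳ (λ i → 𝟙 (upper i) * s i) 2 half) ⟨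
        S * p + (sum (map r half) + sum (map (λ i → 𝟙 (upper i) * s i * 2) half))
          ≡⟨ cong (S * p +_) (sum-map-+ r (λ i → 𝟙 (upper i) * s i * 2) half) ⟨
        S * p + sum (map (λ i → r i + 𝟙 (upper i) * s i * 2) half)
          ≡⟨ cong (λ xs → S * p + sum xs) (map-cong r+2s≡s+p half) ⟩
        S * p + sum (map (λ i → s i + 𝟙 (upper i) * p) half)
          ≡⟨ cong (S * p +_) (sum-map-+ s (λ i → 𝟙 (upper i) * p) half) ⟩
        S * p + (sum (map s half) + sum (map (λ i → 𝟙 (upper i) * p) half))
          ≡⟨ cong₂ (λ u v → S * p + (u + v)) (sum-↭ s-perm) (sum-map-*ʳ (𝟙 ∘ upper) p half) ⟩
        S * p + (sum half + μ * p) ∎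
        where
        open ≡-Reasoning
        X = sum (map (λ i → 𝟙 (upper i) * s i) half)
        lemma : ∀ a b c → a + b + c ≡ b + (a + c)
        lemma = solve-∀

      module _ (a-odd : a ≡ 1 mod 2) where

        S≡μ-mod2 : S ≡ μ mod 2
        S≡μ-mod2 = m+n≡0⇒m≡n-mod2 (≡-mod-sym (+-cancelˡ-mod Σi (begin
          Σi + 0                   ≡⟨ +-identityʳ Σi ⟩
          Σi                       ≈⟨ *-oddʳ Σi a-odd ⟨
          Σi * a                   ≡⟨ +-identityʳ (Σi * a) ⟨
          Σi * a + 0               ≈⟨ +-cong-mod ≡-mod-refl (m*n≡0-mod X) ⟨
          Σi * a + X * 2           ≡⟨ eisenstein-identity ⟩
          S * p + (Σi + μ * p)     ≈⟨ +-cong-mod (*-oddʳ S p-odd) (+-cong-mod ≡-mod-refl (*-oddʳ μ p-odd)) ⟩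
          S + (Σi + μ)             ≡⟨ lemma S Σi μ ⟩
          Σi + (S + μ)             ∎)))
          where
          open ≡-mod-Reasoning 2
          Σi = sum half
          X = sum (map (λ i → 𝟙 (upper i) * s i) half)
          lemma : ∀ a b c → a + (b + c) ≡ b + (a + c)
          lemma = solve-∀

        eisenstein : a ^ h ≡ p-1 ^ S mod p
        eisenstein = begin
          a ^ h            ≈⟨ gauss ⟩
          p-1 ^ μ          ≈⟨ p-1^n≡p-1^[n%2] μ ⟩
          p-1 ^ (μ % 2)    ≡⟨ cong (p-1 ^_) (%-≡ S≡μ-mod2) ⟨
          p-1 ^ (S % 2)    ≈⟨ p-1^n≡p-1^[n%2] S ⟨
          p-1 ^ S          ∎
          where open ≡-mod-Reasoning p

    2≤p-1 : 2 ≤ p-1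
    2≤p-1 = +-mono-≤ 0<h 0<h

    units middle : List ℕ
    units  = map suc (upTo p-1)
    middle = map (2 +_) (upTo (p-1 ∸ 2))

    ∈-units⁻ : ∀ {z} → z ∈ units → 0 < z × z < p
    ∈-units⁻ z∈ with j , j∈ , refl ← ∈-map⁻ suc z∈ = z<s , s≤s (∈-upTo⁻ j∈)

    ∈-units⁺ : ∀ {z} → 0 < z → z < p → z ∈ units
    ∈-units⁺ {suc j} _ (s≤s j<p-1) = ∈-map⁺ suc (∈-upTo⁺ j<p-1)

    ∈-middle⁻ : ∀ {z} → z ∈ middle → 2 ≤ z × z < p-1
    ∈-middle⁻ z∈ with j , j∈ , refl ← ∈-map⁻ (2 +_) z∈ =
      s≤s (s≤s z≤n) , subst (2 + j <_) (m+[n∸m]≡n 2≤p-1) (+-monoʳ-< 2 (∈-upTo⁻ j∈))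

    ∈-middle⁺ : ∀ {z} → 2 ≤ z → z < p-1 → z ∈ middle
    ∈-middle⁺ {suc (suc j)} (s≤s (s≤s _)) z<p-1 = ∈-map⁺ (2 +_) (∈-upTo⁺ (∸-monoˡ-< z<p-1 (s≤s (s≤s z≤n))))

    length-units : length units ≡ p-1
    length-units = trans (length-map suc (upTo p-1)) (length-upTo p-1)

    units-unique : Unique units
    units-unique = Unique.map⁺ suc-injective (Unique.upTo⁺ p-1)

    units↭1∷p-1∷middle : units ↭ 1 ∷ p-1 ∷ middle
    units↭1∷p-1∷middle = unique-⊆⇒↭ units-unique units⊆ (≤-reflexive |units|≡)
      where
      units⊆ : ∀ {z} → z ∈ units → z ∈ 1 ∷ p-1 ∷ middle
      units⊆ {z} z∈ with z ≟ 1 | z ≟ p-1 | ∈-units⁻ z∈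
      ... | yes refl | _        | _         = here refl
      ... | no  _    | yes refl | _         = there (here refl)
      ... | no  z≢1  | no z≢p-1 | 0<z , z<p =
        there (there (∈-middle⁺ (≤∧≢⇒< 0<z (z≢1 ∘ sym)) (≤∧≢⇒< (≤-pred z<p) z≢p-1)))
      |units|≡ : 2 + length middle ≡ length units
      |units|≡ = begin
        2 + length middle         ≡⟨ cong (2 +_) (trans (length-map _ (upTo (p-1 ∸ 2))) (length-upTo _)) ⟩
        2 + (p-1 ∸ 2)             ≡⟨ m+[n∸m]≡n 2≤p-1 ⟩
        p-1                       ≡⟨ length-units ⟨
        length units              ∎
        where open ≡-Reasoning

    1<p : 1 < p
    1<p = s≤s (≤-trans (s≤s z≤n) 2≤p-1)

    p-1≢1 : ¬ p-1 ≡ 1 mod p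
    p-1≢1 p-1≡1 = <⇒≢ 2≤p-1 (sym (≡-mod⇒≡ ≤-refl 1<p p-1≡1))

    p∤1 : p ∤ 1
    p∤1 = 0<x<p⇒p∤x z<s 1<p

    ∈-middle⇒<p : ∀ {z} → z ∈ middle → z < p
    ∈-middle⇒<p z∈ = ≤-trans (proj₂ (∈-middle⁻ z∈)) (n≤1+n p-1)

    ∈-middle⇒p∤ : ∀ {z} → z ∈ middle → p ∤ z
    ∈-middle⇒p∤ z∈ = 0<x<p⇒p∤x (≤-trans z<s (proj₁ (∈-middle⁻ z∈))) (∈-middle⇒<p z∈)

    ¬self-inverse : ∀ {z} → z ∈ middle → ¬ z * z ≡ 1 mod p
    ¬self-inverse {zero}  z∈ _ with () ← proj₁ (∈-middle⁻ z∈)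
    ¬self-inverse {suc u} z∈ zz≡1 with euclidsLemma u (2 + u) prime
      (subst (p ∣_) (lemma u) (≡-mod⇒∣∸ (≡-mod-sym zz≡1)))
      where lemma : ∀ u → u + u * suc u ≡ u * (2 + u)
            lemma = solve-∀
    ... | inj₁ p∣u   = 0<x<p⇒p∤x (≤-pred (proj₁ (∈-middle⁻ z∈))) (<-trans (n<1+n u) (∈-middle⇒<p z∈)) p∣u
    ... | inj₂ p∣2+u = 0<x<p⇒p∤x z<s (s≤s (proj₂ (∈-middle⁻ z∈))) p∣2+u

    inverse∈middle : ∀ {z y} → z ∈ middle → y < p → z * y ≡ 1 mod p → y ∈ middle
    inverse∈middle {z} {0} z∈ _ z0≡1 =
      ⊥-elim (0≢1+n (≡-mod⇒≡ z<s 1<p (subst (_≡ 1 mod p) (*-zeroʳ z) z0≡1)))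
    inverse∈middle {z} {1} z∈ _ z1≡1 =
      ⊥-elim (<⇒≢ (proj₁ (∈-middle⁻ z∈)) (sym (≡-mod⇒≡ (∈-middle⇒<p z∈) 1<p (subst (_≡ 1 mod p) (*-identityʳ z) z1≡1))))
    inverse∈middle {z} {suc (suc y)} z∈ y<p zy≡1 = ∈-middle⁺ (s≤s (s≤s z≤n)) (≤∧≢⇒< (≤-pred y<p) y≢p-1)
      where
      y≢p-1 : suc (suc y) ≢ p-1
      y≢p-1 y≡p-1 = <⇒≢ (proj₂ (∈-middle⁻ z∈)) (≡-mod⇒≡ (∈-middle⇒<p z∈) ≤-refl
        (*-cancelʳ-mod prime (0<x<p⇒p∤x (≤-trans z<s 2≤p-1) ≤-refl)
          (≡-mod-trans (subst (λ t → z * t ≡ 1 mod p) y≡p-1 zy≡1) (≡-mod-sym p-1*p-1≡1))))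

    middle-paired : Paired prime p∤1 middle
    middle-paired = record
      { unique    = Unique.map⁺ (+-cancelˡ-≡ 2 _ _) (Unique.upTo⁺ (p-1 ∸ 2))
      ; bounded   = ∈-middle⇒<p
      ; partnered = λ z∈ → let y , y<p , zy≡1 = ∃-partner prime 1 (∈-middle⇒p∤ z∈)
                           in y , inverse∈middle z∈ y<p zy≡1 , zy≡1
      ; unpaired  = ¬self-inverse
      }

    wilson : p-1 ! ≡ p-1 mod p
    wilson with m , _ , Π≡1ᵐ ← product-paired prime p∤1 middle-paired = begin
      p-1 !                        ≡⟨ product-map-suc-upTo p-1 ⟨
      product units                ≡⟨ product-↭ units↭1∷p-1∷middle ⟩
      1 * (p-1 * product middle)   ≡⟨ *-identityˡ _ ⟩
      p-1 * product middle         ≈⟨ *-cong-mod (≡-mod-refl {a = p-1}) Π≡1ᵐ ⟩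
      p-1 * 1 ^ m                  ≡⟨ cong (p-1 *_) (^-zeroˡ m) ⟩
      p-1 * 1                      ≡⟨ *-identityʳ p-1 ⟩
      p-1                          ∎
      where open ≡-mod-Reasoning p

    units-paired : ∀ {q} (p∤q : p ∤ q) → (∀ x → ¬ x * x ≡ q mod p) → Paired prime p∤q units
    units-paired {q} p∤q nonresidue = record
      { unique    = units-unique
      ; bounded   = proj₂ ∘ ∈-units⁻
      ; partnered = partnered-units
      ; unpaired  = λ {x} _ → nonresidue x
      }
      where
      partnered-units : ∀ {x} → x ∈ units → ∃[ y ] y ∈ units × x * y ≡ q mod p
      partnered-units {x} x∈ with ∃-partner prime q (0<x<p⇒p∤x (proj₁ (∈-units⁻ x∈)) (proj₂ (∈-units⁻ x∈)))
      ... | zero  , _   , x0≡q = ⊥-elim (p∤q (≡0-mod⇒∣ (≡-mod-sym (subst (_≡ q mod p) (*-zeroʳ x) x0≡q))))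
      ... | suc y , y<p , xy≡q = suc y , ∈-units⁺ z<s y<p , xy≡q

    euler-nonresidue : ∀ {q} → p ∤ q → (∀ x → ¬ x * x ≡ q mod p) → q ^ h ≡ p-1 mod p
    euler-nonresidue {q} p∤q nonresidue
      with m , |units|≡m+m , Π≡qᵐ ← product-paired prime p∤q (units-paired p∤q nonresidue) = begin
      q ^ h           ≡⟨ cong (q ^_) h≡m ⟩
      q ^ m           ≈⟨ Π≡qᵐ ⟨
      product units   ≡⟨ product-map-suc-upTo p-1 ⟩
      p-1 !           ≈⟨ wilson ⟩
      p-1             ∎
      where
      open ≡-mod-Reasoning p
      h≡m : h ≡ m
      h≡m = m+m≡n+n⇒m≡n (trans (sym length-units) |units|≡m+m)

    euler-residue : ∀ {q x} → p ∤ q → x * x ≡ q mod p → q ^ h ≡ 1 mod p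
    euler-residue {q} {x} p∤q xx≡q = begin
      q ^ h                 ≈⟨ ^-cong-mod h xx≡q ⟨
      (x * x) ^ h           ≡⟨ ^-distribʳ-* x x h ⟩
      x ^ h * x ^ h         ≈⟨ *-cong-mod gauss gauss ⟩
      p-1 ^ μ * p-1 ^ μ     ≡⟨ ^-distribˡ-+-* p-1 μ μ ⟨
      p-1 ^ (μ + μ)         ≈⟨ p-1^n≡p-1^[n%2] (μ + μ) ⟩
      p-1 ^ ((μ + μ) % 2)   ≡⟨ cong (λ t → p-1 ^ (t % 2)) (+-*2 μ) ⟩
      p-1 ^ (μ * 2 % 2)     ≡⟨ cong (p-1 ^_) (m*n%n≡0 μ 2) ⟩
      1                     ∎
      where
      open ≡-mod-Reasoning p
      open Gauss x (partner-∤ prime p∤q xx≡q)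

    p-1^n≡1⇒even : ∀ n → p-1 ^ n ≡ 1 mod p → n % 2 ≡ 0
    p-1^n≡1⇒even n p-1ⁿ≡1 with %2-cases n
    ... | inj₁ even = even
    ... | inj₂ odd  = ⊥-elim (p-1≢1 (begin
      p-1             ≡⟨ *-identityʳ p-1 ⟨
      p-1 ^ 1         ≡⟨ cong (p-1 ^_) odd ⟨
      p-1 ^ (n % 2)   ≈⟨ p-1^n≡p-1^[n%2] n ⟨
      p-1 ^ n         ≈⟨ p-1ⁿ≡1 ⟩
      1               ∎))
      where open ≡-mod-Reasoning p

    p-1^n≡p-1⇒odd : ∀ n → p-1 ^ n ≡ p-1 mod p → n % 2 ≡ 1
    p-1^n≡p-1⇒odd n p-1ⁿ≡p-1 with %2-cases n
    ... | inj₂ odd  = odd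
    ... | inj₁ even = ⊥-elim (p-1≢1 (begin
      p-1             ≈⟨ p-1ⁿ≡p-1 ⟨
      p-1 ^ n         ≈⟨ p-1^n≡p-1^[n%2] n ⟩
      p-1 ^ (n % 2)   ≡⟨ cong (p-1 ^_) even ⟩
      1               ∎))
      where open ≡-mod-Reasoning p

    legendre≡-1^S : ∀ {q} → p ∤ q → q ≡ 1 mod 2 → legendre q p ≡ -1ℤ ^ℤ (∑[ j < h ] (suc j * q) / p)
    legendre≡-1^S {q} p∤q q-odd with legendre-cases p∤q
    ... | inj₁ ((x , xx≡q) , legendre≡1) = trans legendre≡1 (sym (-1ℤ^even {S} (p-1^n≡1⇒even S
          (≡-mod-trans (≡-mod-sym (eisenstein q-odd)) (euler-residue {x = x} p∤q xx≡q)))))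
      where open Gauss q p∤q
    ... | inj₂ (nonsquare , legendre≡-1) = trans legendre≡-1 (sym (-1ℤ^odd {S} (p-1^n≡p-1⇒odd S
          (≡-mod-trans (≡-mod-sym (eisenstein q-odd)) (euler-nonresidue p∤q λ x xx≡q → nonsquare (x , xx≡q))))))
      where open Gauss q p∤q

open import Defs
open import Data.Nat using (ℕ; _+_; _∸_; _/_)
open import Data.Nat.Primality using (Prime)
open import Data.Nat.Divisibility using (_∤_)
open import Data.Integer using (ℤ; +_; -_; _^_)
open import Data.Product using (_×_)
open import Relation.Binary.PropositionalEquality using (_≡_; _≢_)

open import Data.Nat using (suc; _*_)
open import Data.Nat.Properties using (m+n∸m≡n)
open import Data.Nat.Primality using (prime⇒nonZero)
open import Data.Product using (_,_)
open import Relation.Binary.PropositionalEquality using (refl; sym; trans; cong; cong₂; module ≡-Reasoning)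
open Lemmas using (numSolutions-q*h; 2∤⇒≡1+h+h; 2∤⇒≡1-mod2; prime∤prime; module OddPrime)
open Lemmas using ([h+h]/2≡h; [1+h+h+1]/2≡1+h; q*[h+h]/2≡q*h)

lemma7 : (p q : ℕ) → Prime p → Prime q → 2 ∤ p → 2 ∤ q → p ≢ q →
    (Npq p q ≡ (p + 1) / 2 + floorSum p q ((p ∸ 1) / 2))
    × (legendre q p ≡ (- (+ 1)) ^ (Npq p q ∸ (p + 1) / 2))
lemma7 p q p-prime q-prime 2∤p 2∤q p≢q with h , refl ← 2∤⇒≡1+h+h 2∤p = N≡ , legendre≡
  where
  open OddPrime h p-prime using (legendre≡-1^S)
  S = floorSum p q h

  N≡1+h+S : Npq p q ≡ suc h + S
  N≡1+h+S = trans (cong (numSolutions p q) (q*[h+h]/2≡q*h q h))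
                  (numSolutions-q*h p q h {{prime⇒nonZero p-prime}} {{prime⇒nonZero q-prime}})

  N≡ : Npq p q ≡ (p + 1) / 2 + floorSum p q ((p ∸ 1) / 2)
  N≡ = trans N≡1+h+S (sym (cong₂ (λ a b → a + floorSum p q b) ([1+h+h+1]/2≡1+h h) ([h+h]/2≡h h)))

  legendre≡ : legendre q p ≡ (- (+ 1)) ^ (Npq p q ∸ (p + 1) / 2)
  legendre≡ = begin
    legendre q p                         ≡⟨ legendre≡-1^S (prime∤prime p-prime q-prime p≢q) (2∤⇒≡1-mod2 2∤q) ⟩
    (- (+ 1)) ^ S                        ≡⟨ cong ((- (+ 1)) ^_) (m+n∸m≡n (suc h) S) ⟨
    (- (+ 1)) ^ (suc h + S ∸ suc h)      ≡⟨ cong ((- (+ 1)) ^_) (cong₂ _∸_ N≡1+h+S ([1+h+h+1]/2≡1+h h)) ⟨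
    (- (+ 1)) ^ (Npq p q ∸ (p + 1) / 2)  ∎
    where open ≡-Reasoning
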